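{- Let $F\ge 1$ be an integer, let $f=80F$ and $\rho=1/4$. Let $(\mathtt{C}_M)_{M\ge 1}$ be a family of binary codes as described in the context for this $\rho$. Let $s$ be an integer with $f+1\le s\le 3f+1$, let $M$ be the smallest positive integer with $k_M\ge s$, and let $\mathtt{r}\in\{0,1\}^s$ be any string (thought of as one bit per node of a group $(v_1,\dots,v_s)$ ordered by increasing IDs). Let $\mathtt{w}=\mathtt{C}_M(\mathtt{r}\circ 0^{k_M-s})\in\{0,1\}^{N_M}$, and split $\mathtt{w}$ into $s$ consecutive blocks $(\mathtt{w}_1,\dots,\mathtt{w}_s)$, each of size $\lceil |\mathtt{w}|/s\rceil$ or $\lfloor |\mathtt{w}|/s\rfloor$. Then (1) $\lceil |\mathtt{w}|/s\rceil\le 80$, and (2) the string $\mathtt{r}$ is uniquely determined (decodable) from $(\mathtt{w}_1,\dots,\mathtt{w}_s)$ when up to $F$ of the blocks $\mathtt{w}_i$ are erased (with the positions of the erased blocks known).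
   Context: A binary code $\mathtt{C}:\{0,1\}^k\to\{0,1\}^N$ maps $k$-bit strings to $N$-bit codewords; its rate is $k/N$, and its relative distance $\delta$ means that any two distinct codewords differ in at least $\delta N$ positions, so that any pattern of at most $\delta N-1$ erased positions can be corrected. $H(x)=x\log(1/x)+(1-x)\log(1/(1-x))$ is the binary entropy function. For a given rate $\rho<1/2$, the family $(\mathtt{C}_M)_{M\ge1}$ consists of binary codes $\mathtt{C}_M:\{0,1\}^{k_M}\to\{0,1\}^{N_M}$ with $N_M=2M(2^M-1)$, $k_M=\rho_M N_M$ where $\rho_M\ge\rho$, and relative distance $\delta_M>(1-2\rho)H^{ -1}(1/2)$ (such codes exist by Justesen's construction). $a\circ b$ denotes concatenation and $0^m$ the all-zero string of length $m$. -}

module Defs where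

open import Data.Bool using (Bool; false; true; _≟_)
open import Data.Nat using (ℕ; zero; suc; _+_; _*_; _∸_; _^_; _≤_; _<_)
open import Data.Nat.DivMod using (_/_)
open import Data.Nat.Properties using (m+[n∸m]≡n)
open import Data.Fin using (Fin; zero; suc; toℕ)
open import Data.Fin.Subset using (Subset; _∈_; _∉_; ∣_∣)
open import Data.Vec using (Vec; []; _∷_; _++_; replicate; cast; lookup)
open import Data.Sum using (_⊎_)
open import Data.Product using (_×_)
open import Relation.Nullary using (yes; no)

dist : ∀ {n} → Vec Bool n → Vec Bool n → ℕ
dist [] [] = 0
dist (x ∷ xs) (y ∷ ys) with x ≟ y
... | yes _ = dist xs ys
... | no _ = suc (dist xs ys)

Nlen : ℕ → ℕ
Nlen M = 2 * M * (2 ^ M ∸ 1)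

-- floor and ceiling of m / n (the value at n = 0 is irrelevant; never used)
fdiv : ℕ → ℕ → ℕ
fdiv m zero = 0
fdiv m (suc n) = m / suc n

cdiv : ℕ → ℕ → ℕ
cdiv m zero = 0
cdiv m (suc n) = (m + n) / suc n

-- The real condition  d / n > (1 - 2ρ) H⁻¹(1/2)  with ρ = 1/4, i.e.
--   2d/n > H⁻¹(1/2)  (H⁻¹ the inverse of H on [0,1/2]).
-- Since H is strictly increasing on [0,1/2] with H(1/2)=1 > 1/2, this holds iff
--   2d/n ≥ 1/2, or (2d/n < 1/2 and) H(2d/n) > 1/2.
-- With a = 2d, b = n, H(a/b) > 1/2  ⟺  b^b / (a^a (b-a)^(b-a)) > 2^(b/2)
--   ⟺  b^(2b) > 2^b · a^(2a) · (b-a)^(2(b-a))   (with 0^0 = 1).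
RelDistAbove : (n d : ℕ) → Set
RelDistAbove n d =
  (n ≤ 4 * d) ⊎
  (2 ^ n * ((2 * d) ^ (2 * (2 * d)) * (n ∸ 2 * d) ^ (2 * (n ∸ 2 * d))) < n ^ (2 * n))

pad : ∀ {s k} → s ≤ k → Vec Bool s → Vec Bool k
pad {s} {k} le r = cast (m+[n∸m]≡n le) (r ++ replicate (k ∸ s) false)

start : ∀ {s} → (Fin s → ℕ) → Fin s → ℕ
start b zero = 0
start b (suc i) = b zero + start (λ j → b (suc j)) i

total : ∀ {s} → (Fin s → ℕ) → ℕ
total {zero} b = 0
total {suc s} b = b zero + total (λ j → b (suc j))

InBlock : ∀ {s N} → (Fin s → ℕ) → Fin s → Fin N → Set
InBlock b i j = (start b i ≤ toℕ j) × (toℕ j < start b i + b i)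

{-# OPTIONS --safe #-}
-- (1) For the least M with s ≤ k_M (M > 1) we have k_(M-1) < s, so the rate bound
-- N_(M-1) ≤ 4 k_(M-1) and N_M ≤ 6 N_(M-1) give N_M ≤ 24 s, hence ⌈N_M/s⌉ ≤ 80.
-- (2) Distinct messages have codewords at positive distance, so the code is injective and
-- s ≤ k_M ≤ N_M. If the codewords of r ≠ r′ agree outside F blocks of length ≤ ⌈N/s⌉, their
-- distance d satisfies 80 d ≤ 80 F ⌈N/s⌉ ≤ (s - 1) ⌈N/s⌉ < 2N, i.e. the relative distance is
-- below 1/40. That contradicts the distance requirement, since H(x) ≤ 1/2 for x = 2d/N ≤ 1/20:
-- with a = 2d and m = N - a, N^N ≤ (4N)^a m^m because (1 + 1/n)^n ≤ 4 (Bernoulli), and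
-- (4N)^(2a) ≤ 2^N a^(2a) once N ≥ 20 a.
module Submission where

open import Defs
open import Data.Bool using (Bool; false; true; _≟_; if_then_else_)
open import Data.Fin using (Fin; zero; suc; _↑ˡ_; _↑ʳ_)
open import Data.Fin.Properties using (toℕ-↑ˡ; toℕ-↑ʳ; toℕ<n; injective⇒≤; 2↔Bool)
open import Data.Fin.Subset using (Subset; _∉_; ∣_∣)
open import Data.Fin.Subset.Properties using (drop-there)
open import Data.Nat using (ℕ; zero; suc; _+_; _*_; _∸_; _^_; _≤_; _<_; z≤n; s≤s; z<s; ⌊_/2⌋; ⌈_/2⌉)
open import Data.Nat.DivMod using (_/_; m/n*n≤m; /-monoˡ-≤; m≥n⇒m/n>0; m<n*o⇒m/o<n)
open import Data.Nat.Properties hiding (_≟_)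
open import Algebra.Properties.CommutativeSemigroup *-commutativeSemigroup
  using (interchange; x∙yz≈y∙xz; xy∙z≈y∙xz; xy∙z≈x∙zy)
open import Data.Nat.Tactic.RingSolver using (solve-∀)
open import Data.Product using (_×_; _,_)
open import Data.Sum using (_⊎_; inj₁; inj₂; [_,_]′)
open import Data.Vec using (Vec; []; _∷_; _++_; lookup; splitAt)
open import Data.Vec.Properties using (≡-dec; ++-injectiveˡ; cast-sym; lookup-++ˡ; lookup-++ʳ)
import Data.Vec.Recursive as Recursive
open import Data.Vec.Recursive.Properties using (↔Vec)
open import Data.Vec.Relation.Binary.Pointwise.Extensional using (ext; Pointwise-≡⇒≡)
open import Function using (_∘_)
open import Function.Bundles using (_↔_; _↣_; mk↣; Injection)
open import Function.Construct.Composition using (_↔-∘_; _↣-∘_)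
open import Function.Definitions using (Injective)
open import Function.Properties.Inverse using (↔⇒↣; ↔-sym)
open import Relation.Binary.PropositionalEquality
open import Relation.Nullary using (¬_; yes; no; contradiction)
open import Relation.Nullary.Decidable using (decidable-stable)

^-distribʳ-* : ∀ m n o → (m * n) ^ o ≡ m ^ o * n ^ o
^-distribʳ-* m n zero    = refl
^-distribʳ-* m n (suc o) = trans (cong (m * n *_) (^-distribʳ-* m n o)) (interchange m n (m ^ o) (n ^ o))

^-double : ∀ m n → m ^ (2 * n) ≡ m ^ n * m ^ n
^-double m n = trans (cong (λ e → m ^ (n + e)) (+-identityʳ n)) (^-distribˡ-+-* m n n)

-- Bernoulli's inequality (1 - 1/(n+1))^k ≥ 1 - k/(n+1) with denominators cleared, for n = k + t.
bernoulli : ∀ k t → suc (k + t) ^ k * suc t ≤ suc (k + t) * (k + t) ^ k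
bernoulli zero    t = ≤-reflexive (*-comm 1 (suc t))
bernoulli (suc k) t = begin
  suc n ^ suc k * suc t          ≡⟨ xy∙z≈y∙xz (suc n) (suc n ^ k) (suc t) ⟩
  suc n ^ k * (suc n * suc t)    ≤⟨ *-monoʳ-≤ (suc n ^ k) shift ⟩
  suc n ^ k * (n * suc (suc t))  ≡⟨ x∙yz≈y∙xz (suc n ^ k) n (suc (suc t)) ⟩
  n * (suc n ^ k * suc (suc t))  ≤⟨ *-monoʳ-≤ n ih ⟩
  n * (suc n * n ^ k)            ≡⟨ x∙yz≈y∙xz n (suc n) (n ^ k) ⟩
  suc n * n ^ suc k              ∎
  where
  open ≤-Reasoning
  n = suc (k + t)
  shift : suc n * suc t ≤ n * suc (suc t)
  shift = ≤-trans (+-monoˡ-≤ (n * suc t) (s≤s (m≤n+m t k))) (≤-reflexive (sym (*-suc n (suc t))))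
  ih : suc n ^ k * suc (suc t) ≤ suc n * n ^ k
  ih = subst (λ m → suc m ^ k * suc (suc t) ≤ suc m * m ^ k) (+-suc k t) (bernoulli k (suc t))

2*m≤1+n⇒m≤n : ∀ m {n} → 2 * m ≤ suc n → m ≤ n
2*m≤1+n⇒m≤n zero    _ = z≤n
2*m≤1+n⇒m≤n (suc m) 2m≤1+n = ≤-pred (<-≤-trans (m<m+n (suc m) z<s) 2m≤1+n)

[1+n]^k≤2*n^k : ∀ k {n} → 2 * k ≤ suc n → suc n ^ k ≤ 2 * n ^ k
[1+n]^k≤2*n^k k 2k≤1+n with t , refl ← m≤n⇒∃[o]m+o≡n (2*m≤1+n⇒m≤n k 2k≤1+n) =
  *-cancelˡ-≤ (suc (k + t)) (begin
    suc n * suc n ^ k          ≤⟨ *-monoˡ-≤ (suc n ^ k) 1+n≤2[1+t] ⟩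
    2 * suc t * suc n ^ k      ≡⟨ xy∙z≈x∙zy 2 (suc t) (suc n ^ k) ⟩
    2 * (suc n ^ k * suc t)    ≤⟨ *-monoʳ-≤ 2 (bernoulli k t) ⟩
    2 * (suc n * n ^ k)        ≡⟨ x∙yz≈y∙xz 2 (suc n) (n ^ k) ⟩
    suc n * (2 * n ^ k)        ∎)
  where
  open ≤-Reasoning
  n = k + t
  k≤1+t : k ≤ suc t
  k≤1+t = +-cancelˡ-≤ k k (suc t) (subst₂ _≤_ (cong (k +_) (+-identityʳ k)) (sym (+-suc k t)) 2k≤1+n)
  1+n≤2[1+t] : suc n ≤ 2 * suc t
  1+n≤2[1+t] = subst₂ _≤_ (+-suc k t) (cong (suc t +_) (sym (+-identityʳ (suc t)))) (+-monoˡ-≤ (suc t) k≤1+t)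

2*⌊n/2⌋≤n : ∀ n → 2 * ⌊ n /2⌋ ≤ n
2*⌊n/2⌋≤n zero          = z≤n
2*⌊n/2⌋≤n (suc zero)    = z≤n
2*⌊n/2⌋≤n (suc (suc n)) = s≤s (≤-trans (≤-reflexive (+-suc h (h + 0))) (s≤s (2*⌊n/2⌋≤n n)))
  where h = ⌊ n /2⌋

[1+n]^n≤4*n^n : ∀ n → suc n ^ n ≤ 4 * n ^ n
[1+n]^n≤4*n^n n = begin
  suc n ^ n                            ≡⟨ halves (suc n) ⟩
  suc n ^ ⌊ n /2⌋ * suc n ^ ⌈ n /2⌉    ≤⟨ *-mono-≤ ([1+n]^k≤2*n^k ⌊ n /2⌋ (m≤n⇒m≤1+n (2*⌊n/2⌋≤n n)))
                                                   ([1+n]^k≤2*n^k ⌈ n /2⌉ (2*⌊n/2⌋≤n (suc n))) ⟩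
  2 * n ^ ⌊ n /2⌋ * (2 * n ^ ⌈ n /2⌉)  ≡⟨ interchange 2 (n ^ ⌊ n /2⌋) 2 (n ^ ⌈ n /2⌉) ⟩
  4 * (n ^ ⌊ n /2⌋ * n ^ ⌈ n /2⌉)      ≡⟨ cong (4 *_) (halves n) ⟨
  4 * n ^ n                            ∎
  where
  open ≤-Reasoning
  halves : ∀ m → m ^ n ≡ m ^ ⌊ n /2⌋ * m ^ ⌈ n /2⌉
  halves m = trans (cong (m ^_) (sym (⌊n/2⌋+⌈n/2⌉≡n n))) (^-distribˡ-+-* m ⌊ n /2⌋ ⌈ n /2⌉)

-- (1 + a/m)^m ≤ 4^a with denominators cleared.
[a+m]^[a+m]≤[4[a+m]]^a*m^m : ∀ a m → (a + m) ^ (a + m) ≤ (4 * (a + m)) ^ a * m ^ m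
[a+m]^[a+m]≤[4[a+m]]^a*m^m zero    m = ≤-reflexive (sym (+-identityʳ (m ^ m)))
[a+m]^[a+m]≤[4[a+m]]^a*m^m (suc a) m = begin
  suc n * suc n ^ n                        ≤⟨ *-monoʳ-≤ (suc n) ([1+n]^n≤4*n^n n) ⟩
  suc n * (4 * n ^ n)                      ≤⟨ *-monoʳ-≤ (suc n) (*-monoʳ-≤ 4 ih) ⟩
  suc n * (4 * ((4 * suc n) ^ a * m ^ m))  ≡⟨ reassoc (suc n) ((4 * suc n) ^ a) (m ^ m) ⟩
  4 * suc n * (4 * suc n) ^ a * m ^ m      ∎
  where
  open ≤-Reasoning
  n = a + m
  ih : n ^ n ≤ (4 * suc n) ^ a * m ^ m
  ih = ≤-trans ([a+m]^[a+m]≤[4[a+m]]^a*m^m a m) (*-monoˡ-≤ (m ^ m) (^-monoˡ-≤ a (*-monoʳ-≤ 4 (n≤1+n n))))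
  reassoc : ∀ x y z → x * (4 * (y * z)) ≡ 4 * x * y * z
  reassoc = solve-∀

[4N]^[2a]≤2^N*a^[2a] : ∀ a {N} → 20 * a ≤ N → (4 * N) ^ (2 * a) ≤ 2 ^ N * a ^ (2 * a)
[4N]^[2a]≤2^N*a^[2a] a 20a≤N with t , refl ← m≤n⇒∃[o]m+o≡n 20a≤N = go t
  where
  open ≤-Reasoning
  go : ∀ t → (4 * (20 * a + t)) ^ (2 * a) ≤ 2 ^ (20 * a + t) * a ^ (2 * a)
  go zero rewrite +-identityʳ (20 * a) = begin
    (4 * (20 * a)) ^ (2 * a)  ≡⟨ cong (_^ (2 * a)) (*-assoc 4 20 a) ⟨
    (80 * a) ^ (2 * a)        ≡⟨ ^-distribʳ-* 80 a (2 * a) ⟩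
    80 ^ (2 * a) * a ^ (2 * a) ≡⟨ cong (_* a ^ (2 * a)) (^-*-assoc 80 2 a) ⟨
    (80 ^ 2) ^ a * a ^ (2 * a) ≤⟨ *-monoˡ-≤ (a ^ (2 * a)) (^-monoˡ-≤ a (≤ᵇ⇒≤ (80 ^ 2) (2 ^ 20) _)) ⟩
    (2 ^ 20) ^ a * a ^ (2 * a) ≡⟨ cong (_* a ^ (2 * a)) (^-*-assoc 2 20 a) ⟩
    2 ^ (20 * a) * a ^ (2 * a) ∎
  go (suc t) rewrite +-suc (20 * a) t = begin
    (4 * suc N) ^ (2 * a)          ≡⟨ ^-distribʳ-* 4 (suc N) (2 * a) ⟩
    4 ^ (2 * a) * suc N ^ (2 * a)  ≤⟨ *-monoʳ-≤ (4 ^ (2 * a)) ([1+n]^k≤2*n^k (2 * a) 4a≤1+N) ⟩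
    4 ^ (2 * a) * (2 * N ^ (2 * a)) ≡⟨ x∙yz≈y∙xz (4 ^ (2 * a)) 2 (N ^ (2 * a)) ⟩
    2 * (4 ^ (2 * a) * N ^ (2 * a)) ≡⟨ cong (2 *_) (^-distribʳ-* 4 N (2 * a)) ⟨
    2 * (4 * N) ^ (2 * a)          ≤⟨ *-monoʳ-≤ 2 (go t) ⟩
    2 * (2 ^ N * a ^ (2 * a))      ≡⟨ *-assoc 2 (2 ^ N) (a ^ (2 * a)) ⟨
    2 ^ suc N * a ^ (2 * a)        ∎
    where
    N = 20 * a + t
    4a≤1+N : 2 * (2 * a) ≤ suc N
    4a≤1+N = m≤n⇒m≤1+n (begin
      2 * (2 * a) ≡⟨ *-assoc 2 2 a ⟨
      4 * a       ≤⟨ *-monoˡ-≤ a (≤ᵇ⇒≤ 4 20 _) ⟩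
      20 * a      ≤⟨ m≤m+n (20 * a) t ⟩
      N           ∎)

entropy-bound : ∀ a {N} → 20 * a ≤ N → N ^ (2 * N) ≤ 2 ^ N * (a ^ (2 * a) * (N ∸ a) ^ (2 * (N ∸ a)))
entropy-bound a 20a≤N with m , refl ← m≤n⇒∃[o]m+o≡n (≤-trans (m≤n*m a 20) 20a≤N)
  rewrite m+n∸m≡n a m = begin
  N ^ (2 * N)                      ≡⟨ ^-double N N ⟩
  N ^ N * N ^ N                    ≤⟨ *-mono-≤ N^N≤X*m^m N^N≤X*m^m ⟩
  X * m ^ m * (X * m ^ m)          ≡⟨ interchange X (m ^ m) X (m ^ m) ⟩
  X * X * (m ^ m * m ^ m)          ≡⟨ cong₂ _*_ (^-double (4 * N) a) (^-double m m) ⟨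
  (4 * N) ^ (2 * a) * m ^ (2 * m)  ≤⟨ *-monoˡ-≤ (m ^ (2 * m)) ([4N]^[2a]≤2^N*a^[2a] a 20a≤N) ⟩
  2 ^ N * a ^ (2 * a) * m ^ (2 * m) ≡⟨ *-assoc (2 ^ N) (a ^ (2 * a)) (m ^ (2 * m)) ⟩
  2 ^ N * (a ^ (2 * a) * m ^ (2 * m)) ∎
  where
  open ≤-Reasoning
  N = a + m
  X = (4 * N) ^ a
  N^N≤X*m^m : N ^ N ≤ X * m ^ m
  N^N≤X*m^m = [a+m]^[a+m]≤[4[a+m]]^a*m^m a m

¬RelDistAbove : ∀ {N} d → 40 * d < N → ¬ RelDistAbove N d
¬RelDistAbove {N} d 40d<N (inj₁ N≤4d) = <⇒≱ 40d<N (≤-trans N≤4d (*-monoˡ-≤ d (≤ᵇ⇒≤ 4 40 _)))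
¬RelDistAbove {N} d 40d<N (inj₂ entropy>) =
  <⇒≱ entropy> (entropy-bound (2 * d) (subst (_≤ N) (*-assoc 20 2 d) (<⇒≤ 40d<N)))

Nlen-pos : ∀ {M} → 1 ≤ M → 1 ≤ Nlen M
Nlen-pos {M} 1≤M = *-mono-≤ (≤-trans 1≤M (m≤n*m M 2)) (∸-monoˡ-≤ 1 (^-monoʳ-≤ 2 1≤M))

Nlen-suc-≤ : ∀ m → 1 ≤ m → Nlen (suc m) ≤ 6 * Nlen m
Nlen-suc-≤ m 1≤m = begin
  2 * suc m * (2 * 2 ^ m ∸ 1)          ≤⟨ *-mono-≤ (*-monoʳ-≤ 2 (1+m≤2*m 1≤m)) (2*p∸1≤3*[p∸1] (^-monoʳ-≤ 2 1≤m)) ⟩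
  2 * (2 * m) * (3 * (2 ^ m ∸ 1))      ≡⟨ reassoc m (2 ^ m ∸ 1) ⟩
  6 * (2 * m * (2 ^ m ∸ 1))            ∎
  where
  open ≤-Reasoning
  1+m≤2*m : ∀ {m} → 1 ≤ m → suc m ≤ 2 * m
  1+m≤2*m {zero}  ()
  1+m≤2*m {suc m} _ = s≤s (m<m+n m z<s)
  2*p∸1≤3*[p∸1] : ∀ {p} → 2 ≤ p → 2 * p ∸ 1 ≤ 3 * (p ∸ 1)
  2*p∸1≤3*[p∸1] {suc zero} (s≤s ())
  2*p∸1≤3*[p∸1] {suc (suc q)} _ = +-monoʳ-≤ (suc q) (s≤s (m≤n+m (suc (q + 0)) q))
  reassoc : ∀ x y → 2 * (2 * x) * (3 * y) ≡ 6 * (2 * x * y)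
  reassoc = solve-∀

Nlen-minimal-≤ : ∀ (k : ℕ → ℕ) {s M} → 1 ≤ s → 1 ≤ M → (∀ M → 1 ≤ M → Nlen M ≤ 4 * k M) →
                 (∀ M′ → 1 ≤ M′ → s ≤ k M′ → M ≤ M′) → Nlen M ≤ 80 * s
Nlen-minimal-≤ k {M = suc zero}    1≤s _ _ _ = ≤-trans (≤ᵇ⇒≤ 2 80 _) (*-monoʳ-≤ 80 1≤s)
Nlen-minimal-≤ k {s} {suc (suc m)} _ _ rate minimal = begin
  Nlen (suc (suc m))    ≤⟨ Nlen-suc-≤ (suc m) (s≤s z≤n) ⟩
  6 * Nlen (suc m)      ≤⟨ *-monoʳ-≤ 6 (rate (suc m) (s≤s z≤n)) ⟩
  6 * (4 * k (suc m))   ≤⟨ *-monoʳ-≤ 6 (*-monoʳ-≤ 4 (<⇒≤ k<s)) ⟩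
  6 * (4 * s)           ≡⟨ *-assoc 6 4 s ⟨
  24 * s                ≤⟨ *-monoˡ-≤ s (≤ᵇ⇒≤ 24 80 _) ⟩
  80 * s                ∎
  where
  open ≤-Reasoning
  k<s : k (suc m) < s
  k<s = ≰⇒> λ s≤k → 1+n≰n (minimal (suc m) (s≤s z≤n) s≤k)

fdiv≤cdiv : ∀ m n → fdiv m n ≤ cdiv m n
fdiv≤cdiv m zero    = z≤n
fdiv≤cdiv m (suc n) = /-monoˡ-≤ (suc n) (m≤m+n m n)

cdiv-≤ : ∀ {m c} n → m ≤ c * n → cdiv m n ≤ c
cdiv-≤ zero    _      = z≤n
cdiv-≤ {m} {c} (suc n) m≤cn = ≤-pred (m<n*o⇒m/o<n (begin-strict
  m + n               <⟨ +-mono-≤-< m≤cn (n<1+n n) ⟩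
  c * suc n + suc n   ≡⟨ +-comm (c * suc n) (suc n) ⟩
  suc c * suc n       ∎))
  where open ≤-Reasoning

[n∸1]*cdiv<m+m : ∀ {m} n → 1 ≤ n → n ≤ m → (n ∸ 1) * cdiv m n < m + m
[n∸1]*cdiv<m+m {m} (suc n) _ 1+n≤m = begin-strict
  n * c          <⟨ m<n+m (n * c) c≥1 ⟩
  suc n * c      ≡⟨ *-comm (suc n) c ⟩
  c * suc n      ≤⟨ m/n*n≤m (m + n) (suc n) ⟩
  m + n          <⟨ +-monoʳ-< m 1+n≤m ⟩
  m + m          ∎
  where
  open ≤-Reasoning
  c = (m + n) / suc n
  c≥1 : 1 ≤ c
  c≥1 = m≥n⇒m/n>0 (+-monoˡ-≤ n (≤-trans (s≤s z≤n) 1+n≤m))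

dist-self : ∀ {n} (x : Vec Bool n) → dist x x ≡ 0
dist-self []       = refl
dist-self (x ∷ xs) with x ≟ x
... | yes _   = dist-self xs
... | no x≢x = contradiction refl x≢x

dist≤length : ∀ {n} (x y : Vec Bool n) → dist x y ≤ n
dist≤length []       []       = z≤n
dist≤length (x ∷ xs) (y ∷ ys) with x ≟ y
... | yes _ = m≤n⇒m≤1+n (dist≤length xs ys)
... | no _  = s≤s (dist≤length xs ys)

dist-++ : ∀ {m n} (x₁ y₁ : Vec Bool m) {x₂ y₂ : Vec Bool n} →
          dist (x₁ ++ x₂) (y₁ ++ y₂) ≡ dist x₁ y₁ + dist x₂ y₂
dist-++ []       []       = refl
dist-++ (x ∷ xs) (y ∷ ys) with x ≟ y
... | yes _ = dist-++ xs ys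
... | no _  = cong suc (dist-++ xs ys)

sumOver : ∀ {s} → Subset s → (Fin s → ℕ) → ℕ
sumOver []      b = 0
sumOver (e ∷ E) b = (if e then b zero else 0) + sumOver E (b ∘ suc)

sumOver-≤ : ∀ {s c} (E : Subset s) {b : Fin s → ℕ} → (∀ i → b i ≤ c) → sumOver E b ≤ ∣ E ∣ * c
sumOver-≤ []          _   = z≤n
sumOver-≤ (true ∷ E)  b≤c = +-mono-≤ (b≤c zero) (sumOver-≤ E (b≤c ∘ suc))
sumOver-≤ (false ∷ E) b≤c = sumOver-≤ E (b≤c ∘ suc)

InBlock-↑ˡ : ∀ {s} (b : Fin (suc s) → ℕ) (j : Fin (b zero)) → InBlock b zero (j ↑ˡ total (b ∘ suc))
InBlock-↑ˡ b j = z≤n , subst (_< b zero) (sym (toℕ-↑ˡ j _)) (toℕ<n j)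

InBlock-↑ʳ : ∀ {s n} (b : Fin (suc s) → ℕ) {i : Fin s} {j : Fin n} →
             InBlock (b ∘ suc) i j → InBlock b (suc i) (b zero ↑ʳ j)
InBlock-↑ʳ b {i} {j} (lo , hi) rewrite toℕ-↑ʳ (b zero) j =
  +-monoʳ-≤ (b zero) lo , ≤-trans (+-monoʳ-< (b zero) hi) (≤-reflexive (sym (+-assoc (b zero) _ _)))

dist-≤-sumOver : ∀ {s n} (b : Fin s → ℕ) (E : Subset s) → total b ≡ n → (x y : Vec Bool n) →
                 (∀ i j → i ∉ E → InBlock b i j → lookup x j ≡ lookup y j) → dist x y ≤ sumOver E b
dist-≤-sumOver {zero}  b []      refl [] [] _ = z≤n
dist-≤-sumOver {suc s} b (e ∷ E) refl x y agree
  with x₁ , x₂ , refl ← splitAt (b zero) x | y₁ , y₂ , refl ← splitAt (b zero) y =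
  ≤-trans (≤-reflexive (dist-++ x₁ y₁))
          (+-mono-≤ (first-block e first-agrees) (dist-≤-sumOver (b ∘ suc) E refl x₂ y₂ rest-agrees))
  where
  open ≡-Reasoning
  first-agrees : zero ∉ e ∷ E → x₁ ≡ y₁
  first-agrees 0∉E = Pointwise-≡⇒≡ (ext λ j → begin
    lookup x₁ j                                ≡⟨ lookup-++ˡ x₁ x₂ j ⟨
    lookup (x₁ ++ x₂) (j ↑ˡ total (b ∘ suc))   ≡⟨ agree zero _ 0∉E (InBlock-↑ˡ b j) ⟩
    lookup (y₁ ++ y₂) (j ↑ˡ total (b ∘ suc))   ≡⟨ lookup-++ˡ y₁ y₂ j ⟩
    lookup y₁ j                                ∎)
  rest-agrees : ∀ i j → i ∉ E → InBlock (b ∘ suc) i j → lookup x₂ j ≡ lookup y₂ j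
  rest-agrees i j i∉E j∈i = begin
    lookup x₂ j                       ≡⟨ lookup-++ʳ x₁ x₂ j ⟨
    lookup (x₁ ++ x₂) (b zero ↑ʳ j)   ≡⟨ agree (suc i) _ (i∉E ∘ drop-there) (InBlock-↑ʳ b j∈i) ⟩
    lookup (y₁ ++ y₂) (b zero ↑ʳ j)   ≡⟨ lookup-++ʳ y₁ y₂ j ⟩
    lookup y₂ j                       ∎
  first-block : ∀ e → (zero ∉ e ∷ E → x₁ ≡ y₁) → dist x₁ y₁ ≤ (if e then b zero else 0)
  first-block true  _     = dist≤length x₁ y₁
  first-block false x₁≡y₁ = ≤-reflexive (trans (cong (dist x₁) (sym (x₁≡y₁ λ ()))) (dist-self x₁))

pad-injective : ∀ {s k} (s≤k : s ≤ k) → Injective _≡_ _≡_ (pad s≤k)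
pad-injective s≤k {r} {r′} eq =
  ++-injectiveˡ r r′ (trans (sym (cast-sym (m+[n∸m]≡n s≤k) eq)) (cast-sym (m+[n∸m]≡n s≤k) refl))

Fin[2^n]↔Vec-Bool : ∀ n → Fin (2 ^ n) ↔ Vec Bool n
Fin[2^n]↔Vec-Bool n = ↔Vec n ↔-∘ (Recursive.lift↔ n 2↔Bool ↔-∘ Recursive.Fin[m^n]↔Fin[m]^n 2 n)

injective⇒length-≤ : ∀ {k n} (f : Vec Bool k → Vec Bool n) → Injective _≡_ _≡_ f → k ≤ n
injective⇒length-≤ {k} {n} f f-injective = ≮⇒≥ λ n<k → <⇒≱ (^-monoʳ-< 2 (s≤s (s≤s z≤n)) n<k) 2^k≤2^n
  where
  g : Fin (2 ^ k) ↣ Fin (2 ^ n)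
  g = ↔⇒↣ (↔-sym (Fin[2^n]↔Vec-Bool n)) ↣-∘ (mk↣ f-injective ↣-∘ ↔⇒↣ (Fin[2^n]↔Vec-Bool k))
  2^k≤2^n : 2 ^ k ≤ 2 ^ n
  2^k≤2^n = injective⇒≤ (Injection.injective g)

code-injective : ∀ {k N} (C : Vec Bool k → Vec Bool N) → 1 ≤ N →
                 (∀ x y → x ≢ y → RelDistAbove N (dist (C x) (C y))) → Injective _≡_ _≡_ C
code-injective {N = N} C 1≤N far {x} {y} Cx≡Cy = decidable-stable (≡-dec _≟_ x y) λ x≢y →
  ¬RelDistAbove 0 1≤N (subst (RelDistAbove N) (trans (cong (dist (C x)) (sym Cx≡Cy)) (dist-self (C x))) (far x y x≢y))

few-erasures⇒40*d<N : ∀ {N s d} F → 80 * F + 1 ≤ s → s ≤ N → d ≤ F * cdiv N s → 40 * d < N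
few-erasures⇒40*d<N {N} {s} {d} F 80F+1≤s s≤N d≤Fc = *-cancelˡ-< 2 (40 * d) N (begin-strict
  2 * (40 * d)  ≡⟨ *-assoc 2 40 d ⟨
  80 * d        ≤⟨ *-monoʳ-≤ 80 d≤Fc ⟩
  80 * (F * c)  ≡⟨ *-assoc 80 F c ⟨
  80 * F * c    ≤⟨ *-monoˡ-≤ c (m+n≤o⇒m≤o∸n (80 * F) 80F+1≤s) ⟩
  (s ∸ 1) * c   <⟨ [n∸1]*cdiv<m+m s (m+n≤o⇒n≤o (80 * F) 80F+1≤s) s≤N ⟩
  N + N         ≡⟨ cong (N +_) (+-identityʳ N) ⟨
  2 * N         ∎)
  where
  open ≤-Reasoning
  c = cdiv N s

theorem3 :
    (F : ℕ) → 1 ≤ F →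
    (k : ℕ → ℕ) → (C : (M : ℕ) → Vec Bool (k M) → Vec Bool (Nlen M)) →
    (∀ M → 1 ≤ M → Nlen M ≤ 4 * k M) →
    (∀ M → 1 ≤ M → (x y : Vec Bool (k M)) → x ≢ y →
      RelDistAbove (Nlen M) (dist (C M x) (C M y))) →
    (s : ℕ) → 80 * F + 1 ≤ s → s ≤ 3 * (80 * F) + 1 →
    (M : ℕ) → 1 ≤ M → (hM : s ≤ k M) →
    (∀ M′ → 1 ≤ M′ → s ≤ k M′ → M ≤ M′) →
    (r : Vec Bool s) →
    (b : Fin s → ℕ) →
    (∀ i → (b i ≡ fdiv (Nlen M) s) ⊎ (b i ≡ cdiv (Nlen M) s)) →
    total b ≡ Nlen M →
    (cdiv (Nlen M) s ≤ 80)
    × ((E : Subset s) → ∣ E ∣ ≤ F → (r′ : Vec Bool s) →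
        (∀ (i : Fin s) (j : Fin (Nlen M)) → i ∉ E → InBlock b i j →
          lookup (C M (pad hM r)) j ≡ lookup (C M (pad hM r′)) j) →
        r ≡ r′)
theorem3 F _ k C rate far s 80F+1≤s _ M 1≤M s≤k minimal r b b-sizes b-total =
  cdiv-≤ s (Nlen-minimal-≤ k 1≤s 1≤M rate minimal) ,
  λ E ∣E∣≤F r′ agree → decidable-stable (≡-dec _≟_ r r′) λ r≢r′ →
    ¬RelDistAbove (dist (codeword r) (codeword r′))
      (few-erasures⇒40*d<N F 80F+1≤s s≤N (begin
        dist (codeword r) (codeword r′)  ≤⟨ dist-≤-sumOver b E b-total (codeword r) (codeword r′) agree ⟩
        sumOver E b                      ≤⟨ sumOver-≤ E block≤ceil ⟩
        ∣ E ∣ * cdiv N s                 ≤⟨ *-monoˡ-≤ (cdiv N s) ∣E∣≤F ⟩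
        F * cdiv N s                     ∎))
      (far M 1≤M _ _ (r≢r′ ∘ pad-injective s≤k))
  where
  open ≤-Reasoning
  N = Nlen M
  codeword : Vec Bool s → Vec Bool N
  codeword = C M ∘ pad s≤k
  1≤s : 1 ≤ s
  1≤s = m+n≤o⇒n≤o (80 * F) 80F+1≤s
  s≤N : s ≤ N
  s≤N = ≤-trans s≤k (injective⇒length-≤ (C M) (code-injective (C M) (Nlen-pos 1≤M) (far M 1≤M)))
  block≤ceil : ∀ i → b i ≤ cdiv N s
  block≤ceil i = [ (λ floor → ≤-trans (≤-reflexive floor) (fdiv≤cdiv N s)) , ≤-reflexive ]′ (b-sizes i)
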